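{- Let $n>1$ be an integer. With the notation of the context, $\mathcal{M}_1:=\{(\mathbf v,1):\mathbf v\in\mathcal B\}$ is a large index set. If $n$ is odd, $\mathcal M_1$ is the only large index set. If $n$ is even, there is exactly one other large index set, namely \[ \mathcal M_2:=\{(\mathbf v,d_{\mathbf v}):\mathbf v\in\mathcal B\},\qquad d_{\mathbf v}=\begin{cases}1 & \text{if }\mathbf v\equiv\mathbf 0\bmod 2,\\ 2&\text{otherwise.}\end{cases} \]
   Context: Let $\mathcal B$ be the set of $\mathbf v=(v_1,v_2,v_3)\in(\mathbb{Z}/n\mathbb{Z})^3\setminus\{\mathbf 0\}$ such that some coordinate $v_i=0$ and some two coordinates $v_j=v_k$ ($j\ne k$) are equal. For $\mathbf v,\mathbf w\in(\mathbb{Z}/n\mathbb{Z})^3$, $\mathbf v\cdot\mathbf w=v_1w_1+v_2w_2+v_3w_3\in\mathbb{Z}/n\mathbb{Z}$. Every $\mathbf v\in\mathcal B$ is a multiple $\mathbf v=k\mathbf v_{\min}$ ($k\in\mathbb{Z}/n\mathbb{Z}$) of a unique $\mathbf v_{\min}\in\mathcal B_{\min}=\{(1,0,0),(0,1,0),(0,0,1),(1,1,0),(1,0,1),(0,1,1)\}$, and $f:\mathcal B\to(\mathbb{Z}/n\mathbb{Z})^3$ is defined by $f(\mathbf v)=f(\mathbf v_{\min})$ with $f(1,0,0)=(0,1,-1)$, $f(0,1,0)=(-1,0,1)$, $f(0,0,1)=(1,-1,0)$, $f(1,1,0)=(1,-1,0)$, $f(1,0,1)=(-1,0,1)$, $f(0,1,1)=(0,1,-1)$.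 Let $\mathbf e_1,\mathbf e_2,\mathbf e_3$ be the standard basis vectors and $\mathcal I=\{(\mathbf e_i,d): i\in\{1,2,3\},\ d\mid n\}$. Two elements $(\mathbf v,d),(\mathbf w,e)\in\mathcal B\times\{\text{positive divisors of } n\}$ are unlinked if at least one holds: (1) both $(\mathbf v,d),(\mathbf w,e)\notin\mathcal I$; (2) $\mathbf w\cdot f(\mathbf v)\equiv0\bmod d$ and $\mathbf v\cdot f(\mathbf w)\equiv 0\bmod e$; (3) $d,e$ are both even, $\mathbf w\cdot f(\mathbf v)\equiv d/2\bmod d$ and $\mathbf v\cdot f(\mathbf w)\equiv e/2\bmod e$ (reductions mod $d$, $e$ make sense since $d,e\mid n$). Otherwise they are linked. For $d\in\{1,2\}$ with $d\mid n$ let $\mathcal J_d=\{(\mathbf e_i,d):i=1,2,3\}$. A large index set is a subset $\mathcal M\subseteq\mathcal B\times\{\text{positive divisors of }n\}$ that is maximal with respect to inclusion among subsets whose elements are pairwise unlinked, and that contains $\mathcal J_d$ for some $d\in\{1,2\}$ with $d\mid n$. For $n$ even, "$\mathbf v\equiv\mathbf 0\bmod 2$" means all coordinates of $\mathbf v$ are even. -}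

module Defs where

open import Data.Nat as ℕ using (ℕ; _≡ᵇ_; _/_)
open import Data.Nat.Divisibility as ℕD using ()
open import Data.Integer as ℤ using (ℤ; +_; -_; _-_)
open import Data.Integer.Divisibility as ℤD using ()
open import Data.Fin using (Fin; toℕ)
open import Data.Bool using (Bool; true; false; if_then_else_; _∧_)
open import Data.Product using (_×_; _,_; proj₁; proj₂; ∃)
open import Data.Sum using (_⊎_)
open import Relation.Nullary using (¬_)
open import Relation.Binary.PropositionalEquality using (_≡_; _≢_)
open import Function.Bundles using (_⇔_)

-- Elements of (ℤ/nℤ)^3, with ℤ/nℤ represented by Fin n.
V : ℕ → Set
V n = Fin n × Fin n × Fin n

-- Raw candidates (v , d); validity (v ∈ 𝓑, d ∣ n) is imposed separately.
Raw : ℕ → Set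
Raw n = V n × ℕ

IsZ : ∀ {n} → Fin n → Set
IsZ a = toℕ a ≡ 0

InB : ∀ {n} → V n → Set
InB (a , b , c) =
  ¬ (IsZ a × IsZ b × IsZ c) ×
  (IsZ a ⊎ IsZ b ⊎ IsZ c) ×
  (a ≡ b ⊎ a ≡ c ⊎ b ≡ c)

-- (v , d) ∈ 𝓑 × {positive divisors of n}   (n > 1, so d ∣ n forces d > 0)
Valid : (n : ℕ) → Raw n → Set
Valid n (v , d) = InB v × d ℕD.∣ n

data Bmin : Set where
  e1 e2 e3 e12 e13 e23 : Bmin

isZ : ∀ {n} → Fin n → Bool
isZ a = toℕ a ≡ᵇ 0

-- v_min: the unique element of 𝓑_min of which v ∈ 𝓑 is a multiple
vmin : ∀ {n} → V n → Bmin
vmin (a , b , c) =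
  if isZ b ∧ isZ c then e1 else
  if isZ a ∧ isZ c then e2 else
  if isZ a ∧ isZ b then e3 else
  if isZ c then e12 else
  if isZ b then e13 else e23

ℤ³ : Set
ℤ³ = ℤ × ℤ × ℤ

fmin : Bmin → ℤ³
fmin e1  = (+ 0 , + 1 , - + 1)
fmin e2  = (- + 1 , + 0 , + 1)
fmin e3  = (+ 1 , - + 1 , + 0)
fmin e12 = (+ 1 , - + 1 , + 0)
fmin e13 = (- + 1 , + 0 , + 1)
fmin e23 = (+ 0 , + 1 , - + 1)

f : ∀ {n} → V n → ℤ³
f v = fmin (vmin v)

-- v · w computed with integer representatives; reductions mod d ∣ n are well defined.
dot : ∀ {n} → V n → ℤ³ → ℤ
dot (a , b , c) (x , y , z) =
  (+ toℕ a) ℤ.* x ℤ.+ (+ toℕ b) ℤ.* y ℤ.+ (+ toℕ c) ℤ.* z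

IsE : ∀ {n} → V n → Set
IsE (a , b , c) =
  (toℕ a ≡ 1 × IsZ b × IsZ c) ⊎
  (IsZ a × toℕ b ≡ 1 × IsZ c) ⊎
  (IsZ a × IsZ b × toℕ c ≡ 1)

-- membership in 𝓘 (for valid elements)
InI : ∀ {n} → Raw n → Set
InI (v , d) = IsE v

Unlinked : ∀ {n} → Raw n → Raw n → Set
Unlinked (v , d) (w , e) =
  (¬ InI (v , d) × ¬ InI (w , e)) ⊎
  ((+ d) ℤD.∣ dot w (f v) × (+ e) ℤD.∣ dot v (f w)) ⊎
  (2 ℕD.∣ d × 2 ℕD.∣ e ×
   (+ d) ℤD.∣ (dot w (f v) - + (d / 2)) ×
   (+ e) ℤD.∣ (dot v (f w) - + (e / 2)))

Subset : ℕ → Set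
Subset n = Raw n → Bool

_∈ˢ_ : ∀ {n} → Raw n → Subset n → Set
x ∈ˢ M = M x ≡ true

IsSubsetOfBD : (n : ℕ) → Subset n → Set
IsSubsetOfBD n M = ∀ x → x ∈ˢ M → Valid n x

_⊆ˢ_ : ∀ {n} → Subset n → Subset n → Set
M ⊆ˢ N = ∀ x → x ∈ˢ M → x ∈ˢ N

PairwiseUnlinked : ∀ {n} → Subset n → Set
PairwiseUnlinked M = ∀ x y → x ∈ˢ M → y ∈ˢ M → x ≢ y → Unlinked x y

ContainsJ : ∀ {n} → ℕ → Subset n → Set
ContainsJ d M = ∀ v → IsE v → (v , d) ∈ˢ M

LargeIndexSet : (n : ℕ) → Subset n → Set
LargeIndexSet n M =
  IsSubsetOfBD n M ×
  PairwiseUnlinked M ×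
  (∀ (N : Subset n) → IsSubsetOfBD n N → M ⊆ˢ N → PairwiseUnlinked N → N ⊆ˢ M) ×
  ∃ λ d → (d ≡ 1 ⊎ d ≡ 2) × d ℕD.∣ n × ContainsJ d M

InM1 : ∀ {n} → Raw n → Set
InM1 (v , d) = InB v × d ≡ 1

AllEven : ∀ {n} → V n → Set
AllEven (a , b , c) = 2 ℕD.∣ toℕ a × 2 ℕD.∣ toℕ b × 2 ℕD.∣ toℕ c

InM2 : ∀ {n} → Raw n → Set
InM2 (v , d) = InB v × ((AllEven v × d ≡ 1) ⊎ (¬ AllEven v × d ≡ 2))

Represents : ∀ {n} → Subset n → (Raw n → Set) → Set
Represents M P = ∀ x → (x ∈ˢ M) ⇔ P x

module Submission where

-- Every w ∈ 𝓑 is k · v_min, and each v_min has a pivot: a basis vector e_p with e_p · f(w) = 1.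
-- In a pairwise unlinked set containing 𝓙_d, the element (e_p , d) pins down the index e of every
-- (w , e): for d = 1, condition (2) gives e ∣ 1; for d = 2, either e = 1 and w · f(e_p) is even,
-- or (condition (3), e ∣ 1 - e/2) e = 2 and w · f(e_p) is odd. Mod 2, w is 0 when k is even and
-- v_min when k is odd, so w · f(e_p) is odd exactly when w ≢ 0 mod 2. Hence every pairwise
-- unlinked set containing 𝓙₁ (resp. 𝓙₂) lies inside 𝓜₁ (resp. 𝓜₂), which is therefore the only
-- large index set through 𝓙_d. 𝓜₂ is itself pairwise unlinked because v · f(e_i) and e_i · f(v)
-- have the same parity for every v ∈ 𝓑_min.

open import Defs
open import Data.Nat using (ℕ; _<_)
open import Data.Nat.Divisibility using (_∣_)
open import Data.Product using (_×_; ∃)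
open import Data.Sum using (_⊎_)
open import Relation.Nullary using (¬_)
open import Function.Bundles using (_⇔_)

open import Data.Fin using (Fin; toℕ) renaming (zero to fz; suc to fs)
open import Data.Fin.Properties using (toℕ-injective) renaming (_≟_ to _≟ᶠ_)
open import Data.Integer using (ℤ; +_; -_; _-_; _+_; _*_)
open import Data.Integer.Divisibility using () renaming (_∣_ to _∣ℤ_)
import Data.Integer.Divisibility.Signed as Signed
open import Data.Integer.Tactic.RingSolver using (solve-∀)
open import Data.Nat using (suc; s≤s; _/_) renaming (_*_ to _*ℕ_)
open import Data.Nat.DivMod using (m*n/n≡m)
open import Data.Nat.Divisibility
  using (divides; _∣0; 1∣_; ∣1⇒≡1; 0∣⇒≡0; ∣-refl; ∣m∣n⇒∣m+n; >⇒∤; _∣?_)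
open import Data.Nat.Properties using (≤-refl; m≤m*n) renaming (_≟_ to _≟ℕ_)
open import Data.Product using (_,_; proj₁; proj₂)
import Data.Product as Product
open import Data.Product.Properties using (≡-dec)
open import Data.Sum using (inj₁; inj₂; [_,_]′)
import Data.Sum as Sum
open import Function using (_∘_)
open import Function.Bundles using (mk⇔; Equivalence)
open import Relation.Binary.Definitions using (DecidableEquality)
open import Relation.Binary.PropositionalEquality using (_≡_; refl; sym; cong; cong₂; subst)
open import Relation.Nullary using (Dec; yes; no; does; contradiction)
open import Relation.Nullary.Decidable using (_×-dec_; _⊎-dec_; ¬?)

2∤1 : ¬ 2 ∣ 1
2∤1 = >⇒∤ ≤-refl

2∣-or-2∣suc : ∀ k → 2 ∣ k ⊎ 2 ∣ suc k
2∣-or-2∣suc 0       = inj₁ (2 ∣0)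
2∣-or-2∣suc (suc k) = [ inj₂ ∘ ∣m∣n⇒∣m+n ∣-refl , inj₁ ]′ (2∣-or-2∣suc k)

∣1-half⇒≡2 : ∀ {e} → 2 ∣ e → + e ∣ℤ + 1 - + (e / 2) → e ≡ 2
∣1-half⇒≡2 (divides q refl) e∣ =
  ≡2 q (subst (λ h → + (q *ℕ 2) ∣ℤ + 1 - + h) (m*n/n≡m q 2) e∣)
  where
  ≡2 : ∀ q → + (q *ℕ 2) ∣ℤ + 1 - + q → q *ℕ 2 ≡ 2
  ≡2 0             0∣1 = contradiction (0∣⇒≡0 0∣1) λ ()
  ≡2 1             _   = refl
  ≡2 (suc (suc k)) e∣  = contradiction e∣ (>⇒∤ (m≤m*n (suc (suc k)) 2))

infix 4 _≡₂_

Even : ℤ → Set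
Even X = + 2 Signed.∣ X

_≡₂_ : ℤ → ℤ → Set
X ≡₂ Y = Even (X - Y)

Odd : ℤ → Set
Odd X = X ≡₂ + 1

SameParity : ℤ → ℤ → Set
SameParity X Y = (Even X × Even Y) ⊎ (Odd X × Odd Y)

even⇒¬odd : ∀ {X} → Even X → ¬ Odd X
even⇒¬odd {X} p q = 2∤1 (Signed.∣⇒∣ᵤ (subst Even (X-[X-1]≡1 X) (Signed.∣m∣n⇒∣m-n p q)))
  where
  X-[X-1]≡1 : ∀ X → X - (X - + 1) ≡ + 1
  X-[X-1]≡1 = solve-∀

≡₂-trans : ∀ {X Y Z} → X ≡₂ Y → Y ≡₂ Z → X ≡₂ Z
≡₂-trans {X} {Y} {Z} p q = subst Even (telescope X Y Z) (Signed.∣m∣n⇒∣m+n p q)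
  where
  telescope : ∀ X Y Z → (X - Y) + (Y - Z) ≡ X - Z
  telescope = solve-∀

even-resp-≡₂ : ∀ {X Y} → X ≡₂ Y → Even Y → Even X
even-resp-≡₂ {X} {Y} p q = subst Even (split X Y) (Signed.∣m∣n⇒∣m+n p q)
  where
  split : ∀ X Y → (X - Y) + Y ≡ X
  split = solve-∀

0≡₂0 : + 0 ≡₂ + 0
0≡₂0 = Signed.divides (+ 0) refl

both-zero : SameParity (+ 0) (+ 0)
both-zero = inj₁ (Signed.divides (+ 0) refl , Signed.divides (+ 0) refl)

odd+1 : Odd (+ 1)
odd+1 = Signed.divides (+ 0) refl

odd-1 : Odd (- + 1)
odd-1 = Signed.divides (- + 1) refl

sameParity-respˡ-≡₂ : ∀ {X X′ Y} → X ≡₂ X′ → SameParity X′ Y → SameParity X Y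
sameParity-respˡ-≡₂ {X} {X′} p =
  Sum.map (Product.map₁ (even-resp-≡₂ {X} p)) (Product.map₁ (≡₂-trans {X} {X′} p))

sameParity-+1⇒odd : ∀ {X} → SameParity X (+ 1) → Odd X
sameParity-+1⇒odd (inj₁ (_ , even-1)) = contradiction (Signed.∣⇒∣ᵤ even-1) 2∤1
sameParity-+1⇒odd (inj₂ (odd , _))    = odd

odd-suc : ∀ {k} → ¬ 2 ∣ suc k → Odd (+ suc k)
odd-suc {k} 2∤k+1 = [ Signed.∣ᵤ⇒∣ , (λ 2∣k+1 → contradiction 2∣k+1 2∤k+1) ]′ (2∣-or-2∣suc k)

infixl 7 _·_
infix 4 _≡₂³_

_·_ : ℤ³ → ℤ³ → ℤ
(a , b , c) · (x , y , z) = a * x + b * y + c * z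

_≡₂³_ : ℤ³ → ℤ³ → Set
(a , b , c) ≡₂³ (a′ , b′ , c′) = a ≡₂ a′ × b ≡₂ b′ × c ≡₂ c′

⟦_⟧ : ∀ {n} → V n → ℤ³
⟦ a , b , c ⟧ = + toℕ a , + toℕ b , + toℕ c

dot-respˡ-≡₂ : ∀ {n} (w : V n) u z → ⟦ w ⟧ ≡₂³ u → dot w z ≡₂ u · z
dot-respˡ-≡₂ (a , b , c) (a′ , b′ , c′) (x , y , z) (p , q , r) =
  subst Even (expand (+ toℕ a) (+ toℕ b) (+ toℕ c) a′ b′ c′ x y z)
    (Signed.∣m∣n⇒∣m+n (Signed.∣m∣n⇒∣m+n (Signed.∣m⇒∣m*n x p) (Signed.∣m⇒∣m*n y q))
                      (Signed.∣m⇒∣m*n z r))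
  where
  expand : ∀ a b c a′ b′ c′ x y z →
    (a - a′) * x + (b - b′) * y + (c - c′) * z
      ≡ (a * x + b * y + c * z) - (a′ * x + b′ * y + c′ * z)
  expand = solve-∀

even-dot : ∀ {n} {w : V n} → AllEven w → ∀ z → Even (dot w z)
even-dot (p , q , r) (x , y , z) =
  Signed.∣m∣n⇒∣m+n (Signed.∣m∣n⇒∣m+n (even x p) (even y q)) (even z r)
  where
  even : ∀ {k} X → 2 ∣ k → Even (+ k * X)
  even {k} X 2∣k = Signed.∣m⇒∣m*n {m = + k} X (Signed.∣ᵤ⇒∣ 2∣k)

vec : Bmin → ℤ³
vec e1  = + 1 , + 0 , + 0
vec e2  = + 0 , + 1 , + 0
vec e3  = + 0 , + 0 , + 1
vec e12 = + 1 , + 1 , + 0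
vec e13 = + 1 , + 0 , + 1
vec e23 = + 0 , + 1 , + 1

≡₂-vmin : ∀ {n} (w : V n) → InB w → ¬ AllEven w → ⟦ w ⟧ ≡₂³ vec (vmin w)
≡₂-vmin (fz , fz , fz) (nonzero , _) _ = contradiction (refl , refl , refl) nonzero
≡₂-vmin (fs _ , fs _ , fs _) (_ , hasZero , _) _ = [ (λ ()) , [ (λ ()) , (λ ()) ]′ ]′ hasZero
≡₂-vmin (fs a , fz , fz) _ ¬ev = odd-suc (λ p → ¬ev (p , 2 ∣0 , 2 ∣0)) , 0≡₂0 , 0≡₂0
≡₂-vmin (fz , fs b , fz) _ ¬ev = 0≡₂0 , odd-suc (λ p → ¬ev (2 ∣0 , p , 2 ∣0)) , 0≡₂0
≡₂-vmin (fz , fz , fs c) _ ¬ev = 0≡₂0 , 0≡₂0 , odd-suc (λ p → ¬ev (2 ∣0 , 2 ∣0 , p))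
≡₂-vmin (fs a , fs .a , fz) (_ , _ , inj₁ refl) ¬ev = odd , odd , 0≡₂0
  where
  odd : Odd (+ suc (toℕ a))
  odd = odd-suc (λ p → ¬ev (p , p , 2 ∣0))
≡₂-vmin (fs a , fs b , fz) (_ , _ , inj₂ (inj₁ ())) _
≡₂-vmin (fs a , fs b , fz) (_ , _ , inj₂ (inj₂ ())) _
≡₂-vmin (fs a , fz , fs .a) (_ , _ , inj₂ (inj₁ refl)) ¬ev = odd , 0≡₂0 , odd
  where
  odd : Odd (+ suc (toℕ a))
  odd = odd-suc (λ p → ¬ev (p , 2 ∣0 , p))
≡₂-vmin (fs a , fz , fs c) (_ , _ , inj₁ ()) _
≡₂-vmin (fs a , fz , fs c) (_ , _ , inj₂ (inj₂ ())) _
≡₂-vmin (fz , fs b , fs .b) (_ , _ , inj₂ (inj₂ refl)) ¬ev = 0≡₂0 , odd , odd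
  where
  odd : Odd (+ suc (toℕ b))
  odd = odd-suc (λ p → ¬ev (2 ∣0 , p , p))
≡₂-vmin (fz , fs b , fs c) (_ , _ , inj₁ ()) _
≡₂-vmin (fz , fs b , fs c) (_ , _ , inj₂ (inj₁ ())) _

toℕ³-injective : ∀ {n} {a b c a′ b′ c′ : Fin n} →
                 toℕ a ≡ toℕ a′ → toℕ b ≡ toℕ b′ → toℕ c ≡ toℕ c′ → (a , b , c) ≡ (a′ , b′ , c′)
toℕ³-injective p q r = cong₂ _,_ (toℕ-injective p) (cong₂ _,_ (toℕ-injective q) (toℕ-injective r))

unlinked-sym : ∀ {n} {x y : Raw n} → Unlinked x y → Unlinked y x
unlinked-sym = Sum.map Product.swap (Sum.map Product.swap λ (p , q , r , s) → q , p , s , r)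

-- As 2 / 2 computes to 1, condition (3) for d = e = 2 is literally Odd × Odd.
sameParity⇒unlinked : ∀ {n} {v w : V n} → SameParity (dot w (f v)) (dot v (f w)) →
                      Unlinked (v , 2) (w , 2)
sameParity⇒unlinked (inj₁ (p , q)) = inj₂ (inj₁ (Signed.∣⇒∣ᵤ p , Signed.∣⇒∣ᵤ q))
sameParity⇒unlinked (inj₂ (p , q)) = inj₂ (inj₂ (∣-refl , ∣-refl , Signed.∣⇒∣ᵤ p , Signed.∣⇒∣ᵤ q))

_≟ᴿ_ : ∀ {n} → DecidableEquality (Raw n)
_≟ᴿ_ = ≡-dec (≡-dec _≟ᶠ_ (≡-dec _≟ᶠ_ _≟ᶠ_)) _≟ℕ_

equal-or-unlinked : ∀ {n} {N : Subset n} → PairwiseUnlinked N →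
                    ∀ {x y} → x ∈ˢ N → y ∈ˢ N → x ≡ y ⊎ Unlinked x y
equal-or-unlinked pu {x} {y} x∈N y∈N with x ≟ᴿ y
... | yes x≡y = inj₁ x≡y
... | no x≢y  = inj₂ (pu x y x∈N y∈N x≢y)

isZ? : ∀ {n} (a : Fin n) → Dec (IsZ a)
isZ? a = toℕ a ≟ℕ 0

inB? : ∀ {n} (v : V n) → Dec (InB v)
inB? (a , b , c) =
  ¬? (isZ? a ×-dec isZ? b ×-dec isZ? c) ×-dec
  (isZ? a ⊎-dec isZ? b ⊎-dec isZ? c) ×-dec
  (a ≟ᶠ b ⊎-dec a ≟ᶠ c ⊎-dec b ≟ᶠ c)

allEven? : ∀ {n} (v : V n) → Dec (AllEven v)
allEven? (a , b , c) = 2 ∣? toℕ a ×-dec 2 ∣? toℕ b ×-dec 2 ∣? toℕ c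

isE? : ∀ {n} (v : V n) → Dec (IsE v)
isE? (a , b , c) =
  toℕ a ≟ℕ 1 ×-dec isZ? b ×-dec isZ? c ⊎-dec
  isZ? a ×-dec toℕ b ≟ℕ 1 ×-dec isZ? c ⊎-dec
  isZ? a ×-dec isZ? b ×-dec toℕ c ≟ℕ 1

inM1? : ∀ {n} (x : Raw n) → Dec (InM1 x)
inM1? (v , d) = inB? v ×-dec d ≟ℕ 1

inM2? : ∀ {n} (x : Raw n) → Dec (InM2 x)
inM2? (v , d) = inB? v ×-dec (allEven? v ×-dec d ≟ℕ 1 ⊎-dec ¬? (allEven? v) ×-dec d ≟ℕ 2)

does-represents : ∀ {n} {P : Raw n → Set} (P? : ∀ x → Dec (P x)) → Represents (does ∘ P?) P
does-represents P? x with P? x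
... | yes p = mk⇔ (λ _ → p) (λ _ → refl)
... | no ¬p = mk⇔ (λ ()) (λ p → contradiction p ¬p)

record IsGreatestUnlinked (n d : ℕ) (P : Raw n → Set) : Set where
  field
    valid     : ∀ {x} → P x → Valid n x
    unlinked  : ∀ {x y} → P x → P y → Unlinked x y
    containsJ : ∀ {v} → IsE v → P (v , d)
    greatest  : ∀ N → IsSubsetOfBD n N → PairwiseUnlinked N → ContainsJ d N →
                ∀ {x} → x ∈ˢ N → P x

open IsGreatestUnlinked

module _ {n d} {P : Raw n → Set} (G : IsGreatestUnlinked n d P)
         {M : Subset n} (M≈P : Represents M P) where

  private
    M-valid : IsSubsetOfBD n M
    M-valid x x∈M = valid G (Equivalence.to (M≈P x) x∈M)

    M-unlinked : PairwiseUnlinked M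
    M-unlinked x y x∈M y∈M _ = unlinked G (Equivalence.to (M≈P x) x∈M) (Equivalence.to (M≈P y) y∈M)

    M-containsJ : ContainsJ d M
    M-containsJ v v∈I = Equivalence.from (M≈P (v , d)) (containsJ G v∈I)

    M-greatest : ∀ N → IsSubsetOfBD n N → PairwiseUnlinked N → ContainsJ d N → N ⊆ˢ M
    M-greatest N N-valid N-unlinked N-J x x∈N =
      Equivalence.from (M≈P x) (greatest G N N-valid N-unlinked N-J x∈N)

  greatest⇒large : d ≡ 1 ⊎ d ≡ 2 → d ∣ n → LargeIndexSet n M
  greatest⇒large d≤2 d∣n = M-valid , M-unlinked , maximal , d , d≤2 , d∣n , M-containsJ
    where
    maximal : ∀ N → IsSubsetOfBD n N → M ⊆ˢ N → PairwiseUnlinked N → N ⊆ˢ M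
    maximal N N-valid M⊆N N-unlinked =
      M-greatest N N-valid N-unlinked (λ v v∈I → M⊆N _ (M-containsJ v v∈I))

  greatest⇒unique : ∀ M′ → LargeIndexSet n M′ → ContainsJ d M′ → Represents M′ P
  greatest⇒unique M′ (M′-valid , M′-unlinked , M′-maximal , _) M′-J x =
    mk⇔ (greatest G M′ M′-valid M′-unlinked M′-J)
        (λ Px → M′-maximal M M-valid (M-greatest M′ M′-valid M′-unlinked M′-J) M-unlinked x
                  (Equivalence.from (M≈P x) Px))

large⇒containsJ : ∀ {n} {M : Subset n} → LargeIndexSet n M → ContainsJ 1 M ⊎ (2 ∣ n × ContainsJ 2 M)
large⇒containsJ (_ , _ , _ , _ , inj₁ refl , _   , J) = inj₁ J
large⇒containsJ (_ , _ , _ , _ , inj₂ refl , 2∣n , J) = inj₂ (2∣n , J)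

data Axis : Set where
  ax₁ ax₂ ax₃ : Axis

pivot : Bmin → Axis
pivot e1  = ax₂
pivot e2  = ax₃
pivot e3  = ax₁
pivot e12 = ax₁
pivot e13 = ax₃
pivot e23 = ax₂

module _ {m : ℕ} where

  private
    n : ℕ
    n = suc (suc m)

  𝐞 : Axis → V n
  𝐞 ax₁ = fs fz , fz , fz
  𝐞 ax₂ = fz , fs fz , fz
  𝐞 ax₃ = fz , fz , fs fz

  𝐞-IsE : ∀ i → IsE (𝐞 i)
  𝐞-IsE ax₁ = inj₁ (refl , refl , refl)
  𝐞-IsE ax₂ = inj₂ (inj₁ (refl , refl , refl))
  𝐞-IsE ax₃ = inj₂ (inj₂ (refl , refl , refl))

  𝐞-InB : ∀ i → InB (𝐞 i)
  𝐞-InB ax₁ = (λ { (() , _) }) , inj₂ (inj₁ refl) , inj₂ (inj₂ refl)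
  𝐞-InB ax₂ = (λ { (_ , () , _) }) , inj₁ refl , inj₂ (inj₁ refl)
  𝐞-InB ax₃ = (λ { (_ , _ , ()) }) , inj₁ refl , inj₁ refl

  𝐞-¬AllEven : ∀ i → ¬ AllEven (𝐞 i)
  𝐞-¬AllEven ax₁ (2∣1 , _)     = 2∤1 2∣1
  𝐞-¬AllEven ax₂ (_ , 2∣1 , _) = 2∤1 2∣1
  𝐞-¬AllEven ax₃ (_ , _ , 2∣1) = 2∤1 2∣1

  IsE⇒𝐞 : ∀ {v : V n} → IsE v → ∃ λ i → v ≡ 𝐞 i
  IsE⇒𝐞 (inj₁ (p , q , r))        = ax₁ , toℕ³-injective p q r
  IsE⇒𝐞 (inj₂ (inj₁ (p , q , r))) = ax₂ , toℕ³-injective p q r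
  IsE⇒𝐞 (inj₂ (inj₂ (p , q , r))) = ax₃ , toℕ³-injective p q r

  IsE⇒InB : ∀ {v : V n} → IsE v → InB v
  IsE⇒InB v∈I with IsE⇒𝐞 v∈I
  ... | i , refl = 𝐞-InB i

  𝐞-InM2 : ∀ i → InM2 (𝐞 i , 2)
  𝐞-InM2 i = 𝐞-InB i , inj₂ (𝐞-¬AllEven i , refl)

  IsE⇒InM2 : ∀ {v : V n} → IsE v → InM2 (v , 2)
  IsE⇒InM2 v∈I with IsE⇒𝐞 v∈I
  ... | i , refl = 𝐞-InM2 i

  dot-𝐞-pivot : ∀ b → dot (𝐞 (pivot b)) (fmin b) ≡ + 1
  dot-𝐞-pivot e1  = refl
  dot-𝐞-pivot e2  = refl
  dot-𝐞-pivot e3  = refl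
  dot-𝐞-pivot e12 = refl
  dot-𝐞-pivot e13 = refl
  dot-𝐞-pivot e23 = refl

  parity-table : ∀ b i → SameParity (vec b · f (𝐞 i)) (dot (𝐞 i) (fmin b))
  parity-table e1  ax₁ = both-zero
  parity-table e1  ax₂ = inj₂ (odd-1 , odd+1)
  parity-table e1  ax₃ = inj₂ (odd+1 , odd-1)
  parity-table e2  ax₁ = inj₂ (odd+1 , odd-1)
  parity-table e2  ax₂ = both-zero
  parity-table e2  ax₃ = inj₂ (odd-1 , odd+1)
  parity-table e3  ax₁ = inj₂ (odd-1 , odd+1)
  parity-table e3  ax₂ = inj₂ (odd+1 , odd-1)
  parity-table e3  ax₃ = both-zero
  parity-table e12 ax₁ = inj₂ (odd+1 , odd+1)
  parity-table e12 ax₂ = inj₂ (odd-1 , odd-1)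
  parity-table e12 ax₃ = both-zero
  parity-table e13 ax₁ = inj₂ (odd-1 , odd-1)
  parity-table e13 ax₂ = both-zero
  parity-table e13 ax₃ = inj₂ (odd+1 , odd+1)
  parity-table e23 ax₁ = both-zero
  parity-table e23 ax₂ = inj₂ (odd+1 , odd+1)
  parity-table e23 ax₃ = inj₂ (odd-1 , odd-1)

  dot-parity : ∀ (w : V n) → InB w → ¬ AllEven w →
               ∀ i → SameParity (dot w (f (𝐞 i))) (dot (𝐞 i) (f w))
  dot-parity w w∈B ¬ev i =
    sameParity-respˡ-≡₂ {dot w (f (𝐞 i))} {vec (vmin w) · f (𝐞 i)}
      (dot-respˡ-≡₂ w (vec (vmin w)) (f (𝐞 i)) (≡₂-vmin w w∈B ¬ev)) (parity-table (vmin w) i)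

  odd-at-pivot : ∀ (w : V n) → InB w → ¬ AllEven w → Odd (dot w (f (𝐞 (pivot (vmin w)))))
  odd-at-pivot w w∈B ¬ev =
    sameParity-+1⇒odd (subst (SameParity (dot w (f (𝐞 (pivot (vmin w)))))) (dot-𝐞-pivot (vmin w))
                              (dot-parity w w∈B ¬ev (pivot (vmin w))))

  unlinked-pivot : ∀ (w : V n) {d e} → let X = dot w (f (𝐞 (pivot (vmin w)))) in
                   Unlinked (𝐞 (pivot (vmin w)) , d) (w , e) →
                   (+ d ∣ℤ X × e ≡ 1) ⊎ (2 ∣ d × + d ∣ℤ X - + (d / 2) × e ≡ 2)
  unlinked-pivot w (inj₁ (∉I , _)) = contradiction (𝐞-IsE (pivot (vmin w))) ∉I
  unlinked-pivot w {e = e} (inj₂ (inj₁ (d∣X , e∣1))) =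
    inj₁ (d∣X , ∣1⇒≡1 (subst (+ e ∣ℤ_) (dot-𝐞-pivot (vmin w)) e∣1))
  unlinked-pivot w {e = e} (inj₂ (inj₂ (2∣d , 2∣e , d∣X-d/2 , e∣1-e/2))) =
    inj₂ (2∣d , d∣X-d/2 ,
          ∣1-half⇒≡2 2∣e (subst (λ Y → + e ∣ℤ Y - + (e / 2)) (dot-𝐞-pivot (vmin w)) e∣1-e/2))

  containsJ₁⇒index≡1 : ∀ {N : Subset n} → PairwiseUnlinked N → ContainsJ 1 N →
                       ∀ {w e} → (w , e) ∈ˢ N → e ≡ 1
  containsJ₁⇒index≡1 N-unlinked J {w} w∈N
    with equal-or-unlinked N-unlinked (J _ (𝐞-IsE (pivot (vmin w)))) w∈N
  ... | inj₁ eq = sym (cong proj₂ eq)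
  ... | inj₂ u  = [ proj₂ , (λ (2∣1 , _) → contradiction 2∣1 2∤1) ]′ (unlinked-pivot w u)

  unlinked₂-pivot : ∀ (w : V n) {e} → let X = dot w (f (𝐞 (pivot (vmin w)))) in
                    Unlinked (𝐞 (pivot (vmin w)) , 2) (w , e) → (Even X × e ≡ 1) ⊎ (Odd X × e ≡ 2)
  unlinked₂-pivot w u with unlinked-pivot w u
  ... | inj₁ (even , e≡1)    = inj₁ (Signed.∣ᵤ⇒∣ even , e≡1)
  ... | inj₂ (_ , odd , e≡2) = inj₂ (Signed.∣ᵤ⇒∣ odd , e≡2)

  containsJ₂⇒InM2 : ∀ {N : Subset n} → PairwiseUnlinked N → ContainsJ 2 N →
                    ∀ {w e} → InB w → (w , e) ∈ˢ N → InM2 (w , e)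
  containsJ₂⇒InM2 N-unlinked J {w} w∈B w∈N
    with equal-or-unlinked N-unlinked (J _ (𝐞-IsE (pivot (vmin w)))) w∈N
  ... | inj₁ eq = subst InM2 eq (𝐞-InM2 (pivot (vmin w)))
  ... | inj₂ u with allEven? w | unlinked₂-pivot w u
  ... | yes ev | inj₁ (_ , e≡1)  = w∈B , inj₁ (ev , e≡1)
  ... | yes ev | inj₂ (odd , _)  = contradiction odd (even⇒¬odd (even-dot ev _))
  ... | no ¬ev | inj₁ (even , _) = contradiction (odd-at-pivot w w∈B ¬ev) (even⇒¬odd even)
  ... | no ¬ev | inj₂ (_ , e≡2)  = w∈B , inj₂ (¬ev , e≡2)

  𝐞-unlinked-M₂ : ∀ i {w e} → InM2 (w , e) → Unlinked (𝐞 i , 2) (w , e)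
  𝐞-unlinked-M₂ i (_ , inj₁ (ev , refl)) = inj₂ (inj₁ (Signed.∣⇒∣ᵤ (even-dot ev _) , 1∣ _))
  𝐞-unlinked-M₂ i {w} (w∈B , inj₂ (¬ev , refl)) = sameParity⇒unlinked (dot-parity w w∈B ¬ev i)

  IsE⇒unlinked-M₂ : ∀ {v d y} → IsE v → InM2 (v , d) → InM2 y → Unlinked (v , d) y
  IsE⇒unlinked-M₂ v∈I v∈M₂ y∈M₂ with IsE⇒𝐞 v∈I
  ... | i , refl with v∈M₂
  ...   | _ , inj₁ (ev , _)    = contradiction ev (𝐞-¬AllEven i)
  ...   | _ , inj₂ (_ , refl) = 𝐞-unlinked-M₂ i y∈M₂

  M₂-unlinked : ∀ {x y : Raw n} → InM2 x → InM2 y → Unlinked x y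
  M₂-unlinked {v , _} {w , _} x∈M₂ y∈M₂ with isE? v | isE? w
  ... | yes v∈I | _       = IsE⇒unlinked-M₂ v∈I x∈M₂ y∈M₂
  ... | no _    | yes w∈I = unlinked-sym (IsE⇒unlinked-M₂ w∈I y∈M₂ x∈M₂)
  ... | no v∉I  | no w∉I  = inj₁ (v∉I , w∉I)

  M₁-greatest : IsGreatestUnlinked n 1 InM1
  M₁-greatest .valid (w∈B , refl) = w∈B , 1∣ n
  M₁-greatest .unlinked (_ , refl) (_ , refl) = inj₂ (inj₁ (1∣ _ , 1∣ _))
  M₁-greatest .containsJ v∈I = IsE⇒InB v∈I , refl
  M₁-greatest .greatest N N-valid N-unlinked J w∈N =
    proj₁ (N-valid _ w∈N) , containsJ₁⇒index≡1 N-unlinked J w∈N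

  M₂-greatest : 2 ∣ n → IsGreatestUnlinked n 2 InM2
  M₂-greatest _   .valid (w∈B , inj₁ (_ , refl)) = w∈B , 1∣ n
  M₂-greatest 2∣n .valid (w∈B , inj₂ (_ , refl)) = w∈B , 2∣n
  M₂-greatest _   .unlinked = M₂-unlinked
  M₂-greatest _   .containsJ = IsE⇒InM2
  M₂-greatest _   .greatest N N-valid N-unlinked J w∈N =
    containsJ₂⇒InM2 N-unlinked J (proj₁ (N-valid _ w∈N)) w∈N

  M₁≢M₂ : ¬ (∀ (x : Raw n) → InM1 x ⇔ InM2 x)
  M₁≢M₂ M₁≡M₂ with proj₂ (Equivalence.from (M₁≡M₂ (𝐞 ax₁ , 2)) (𝐞-InM2 ax₁))
  ... | ()

lemma4p19 : (n : ℕ) → 1 < n →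
    (∃ λ (M : Subset n) → LargeIndexSet n M × Represents M InM1) ×
    (¬ (2 ∣ n) → ∀ (M : Subset n) → LargeIndexSet n M → Represents M InM1) ×
    (2 ∣ n →
      (∃ λ (M : Subset n) → LargeIndexSet n M × Represents M InM2) ×
      (∀ (M : Subset n) → LargeIndexSet n M → Represents M InM1 ⊎ Represents M InM2) ×
      ¬ (∀ (x : Raw n) → InM1 x ⇔ InM2 x))
lemma4p19 (suc (suc m)) (s≤s (s≤s _)) =
    (does ∘ inM1? , greatest⇒large M₁-greatest M₁-rep (inj₁ refl) (1∣ _) , M₁-rep)
  , (λ 2∤n M M-large →
       [ unique₁ M M-large , (λ (2∣n , _) → contradiction 2∣n 2∤n) ]′ (large⇒containsJ M-large))
  , λ 2∣n →
      (does ∘ inM2? , greatest⇒large (M₂-greatest 2∣n) M₂-rep (inj₂ refl) 2∣n , M₂-rep)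
    , (λ M M-large →
         Sum.map (unique₁ M M-large) (greatest⇒unique (M₂-greatest 2∣n) M₂-rep M M-large ∘ proj₂)
                 (large⇒containsJ M-large))
    , M₁≢M₂
  where
  M₁-rep : Represents (does ∘ inM1?) InM1
  M₁-rep = does-represents inM1?

  M₂-rep : Represents (does ∘ inM2?) InM2
  M₂-rep = does-represents inM2?

  unique₁ : ∀ M → LargeIndexSet (suc (suc m)) M → ContainsJ 1 M → Represents M InM1
  unique₁ = greatest⇒unique M₁-greatest M₁-rep
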